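{- Let $G_\sigma$ be a signed graph and let $P$ be a hypercyclic chain in $G_\sigma$. Then the signed graph $G(P)$, consisting of all vertices and edges of $P$ with their signs, is sign connected.
   Context: A signed graph $G_\sigma=(V,E;\sigma)$ consists of a finite undirected graph, in which loops and multiple edges are allowed, together with $\sigma:E\to\{ -1,+1\}$. Cycles are elementary; a loop is a cycle of length 1. A chain is a walk $x,e_1,x_1,e_2,\dots,y$, not necessarily elementary. Its sign is the product of $\sigma(e_i)$ over its edges, counted with multiplicity. An $\varepsilon$-chain is a chain of sign $\varepsilon$. The graph $G(P)$ of a chain $P$ is the subgraph consisting of the vertices and edges of $P$. An $\varepsilon$-chain $P$ joining $x$ and $y$ is elementary if no other $\varepsilon$-chain joining $x$ and $y$ has a graph that is a proper subgraph of $G(P)$. A hypercyclic chain is an elementary $\varepsilon$-chain (for some $\varepsilon$) whose graph contains a negative cycle. Vertices $u,v$ are sign connected if $u=v$ or both a positive and a negative chain join them. A signed graph is sign connected if every two of its vertices are sign connected. -}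

module Defs where

open import Data.Nat using (ℕ)
open import Data.Fin using (Fin)
open import Data.Product using (_×_; _,_; Σ; Σ-syntax; ∃; ∃-syntax)
open import Data.Sum using (_⊎_)
open import Data.List using (List; []; _∷_)
open import Data.Empty using (⊥)
open import Data.List.Membership.Propositional using (_∈_)
open import Data.List.Relation.Unary.All using (All)
open import Data.List.Relation.Unary.Unique.Propositional using (Unique)
open import Data.Sign using (Sign; _*_) renaming (+ to plus; - to minus)
open import Relation.Binary.PropositionalEquality using (_≡_)
open import Relation.Nullary using (¬_)

-- A finite signed graph; loops and multiple edges allowed.
-- Edge e has (unordered) ends  ends e = (a , b);  a ≡ b means e is a loop.
record SignedGraph : Set where
  field
    nV    : ℕ
    nE    : ℕ
    ends  : Fin nE → Fin nV × Fin nV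
    sign  : Fin nE → Sign

module _ (G : SignedGraph) where
  open SignedGraph G

  V : Set
  V = Fin nV

  E : Set
  E = Fin nE

  Traverses : E → V → V → Set
  Traverses e x y = (ends e ≡ (x , y)) ⊎ (ends e ≡ (y , x))

  -- a chain (walk, not necessarily elementary) from x to y
  data Chain : V → V → Set where
    []   : ∀ {x} → Chain x x
    step : ∀ {x y z} (e : E) → Traverses e x y → Chain y z → Chain x z

  chainSign : ∀ {x y} → Chain x y → Sign
  chainSign []           = plus
  chainSign (step e _ P) = sign e * chainSign P

  edges : ∀ {x y} → Chain x y → List E
  edges []           = []
  edges (step e _ P) = e ∷ edges P

  verts : ∀ {x y} → Chain x y → List V
  verts {x} []       = x ∷ []
  verts {x} (step e _ P) = x ∷ verts P

  _⊑_ : ∀ {x y x' y'} → Chain x y → Chain x' y' → Set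
  Q ⊑ P = (∀ v → v ∈ verts Q → v ∈ verts P) × (∀ e → e ∈ edges Q → e ∈ edges P)

  _⊏_ : ∀ {x y x' y'} → Chain x y → Chain x' y' → Set
  Q ⊏ P = (Q ⊑ P) × ¬ (P ⊑ Q)

  IsElementary : Sign → ∀ {x y} → Chain x y → Set
  IsElementary ε {x} {y} P =
    (chainSign P ≡ ε) × (∀ (Q : Chain x y) → chainSign Q ≡ ε → ¬ (Q ⊏ P))

  -- a cycle (elementary closed chain, length ≥ 1; a loop is a cycle of length 1)
  IsCycle : ∀ {x} → Chain x x → Set
  -- C = x e1 v1 ... v(k-1) ek x : edges pairwise distinct and
  -- v1, ..., v(k-1), x pairwise distinct (= verts R below)
  IsCycle []               = ⊥
  IsCycle C@(step _ _ R)   = Unique (edges C) × Unique (verts R)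

  ContainsNegCycle : ∀ {x y} → Chain x y → Set
  ContainsNegCycle P =
    Σ[ z ∈ V ] Σ[ C ∈ Chain z z ]
      IsCycle C × (chainSign C ≡ minus) × All (_∈ edges P) (edges C)

  IsHypercyclic : ∀ {x y} → Chain x y → Set
  IsHypercyclic P = Σ[ ε ∈ Sign ] IsElementary ε P × ContainsNegCycle P

  -- the signed graph G(P) is sign connected: any two vertices of G(P) are
  -- equal or joined by both a positive and a negative chain in G(P)
  -- (a chain starting in G(P) and using only edges of P lies in G(P))
  SignConnectedIn : ∀ {x y} → Chain x y → Set
  SignConnectedIn P =
    ∀ u v → u ∈ verts P → v ∈ verts P →
      (u ≡ v) ⊎
      ((Σ[ Q ∈ Chain u v ] (chainSign Q ≡ plus)  × All (_∈ edges P) (edges Q)) ×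
       (Σ[ Q ∈ Chain u v ] (chainSign Q ≡ minus) × All (_∈ edges P) (edges Q)))

module Submission where

-- Let P be a chain whose graph contains a negative cycle C.
--   * G(P) is connected: every vertex of P reaches the end y of P along a
--     suffix of P, so any two vertices u, v of P are joined by a chain
--     (suffix from u, followed by the reversed suffix from v) inside G(P).
--   * The base vertex z of C lies on P, as an end of an edge of P.
--   * Conjugating C by a chain W from u to z inside G(P) gives the negative
--     closed chain W · C · W⁻¹ at u, since W and W⁻¹ have the same sign.
--   * Prefixing a chain u → v by this negative closed chain flips its sign,
--     so u and v are joined by chains inside G(P) of both signs.

open import Defs
open import Data.Product using (_×_; _,_; Σ-syntax; proj₁; proj₂)
open import Data.Product.Properties using (,-injectiveˡ; ,-injectiveʳ)
open import Data.Sum using (_⊎_; inj₁; inj₂)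
open import Data.List.Membership.Propositional using (_∈_)
open import Data.List.Relation.Unary.Any using (here; there)
open import Data.List.Relation.Unary.All as All using (All; []; _∷_)
open import Data.Sign using (_*_) renaming (+ to plus; - to minus)
open import Data.Sign.Properties using (*-comm; *-assoc; *-identityʳ)
open import Relation.Binary.PropositionalEquality
  using (_≡_; refl; sym; trans; cong; module ≡-Reasoning)

module ChainCalculus (G : SignedGraph) where
  open SignedGraph G using (sign)

  _++_ : ∀ {a b c} → Chain G a b → Chain G b c → Chain G a c
  []         ++ Q = Q
  step e t P ++ Q = step e t (P ++ Q)

  infixr 5 _++_

  sign-++ : ∀ {a b c} (P : Chain G a b) (Q : Chain G b c) →
            chainSign G (P ++ Q) ≡ chainSign G P * chainSign G Q
  sign-++ []           Q = refl
  sign-++ (step e t P) Q = begin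
    sign e * chainSign G (P ++ Q)               ≡⟨ cong (sign e *_) (sign-++ P Q) ⟩
    sign e * (chainSign G P * chainSign G Q)    ≡⟨ sym (*-assoc (sign e) _ _) ⟩
    (sign e * chainSign G P) * chainSign G Q    ∎
    where open ≡-Reasoning

  all-++ : ∀ {A : E G → Set} {a b c} (P : Chain G a b) (Q : Chain G b c) →
           All A (edges G P) → All A (edges G Q) → All A (edges G (P ++ Q))
  all-++ []           Q []       q = q
  all-++ (step e t P) Q (p ∷ ps) q = p ∷ all-++ P Q ps q

  flip : ∀ {e a b} → Traverses G e a b → Traverses G e b a
  flip (inj₁ p) = inj₂ p
  flip (inj₂ p) = inj₁ p

  reverse : ∀ {a b} → Chain G a b → Chain G b a
  reverse []           = []
  reverse (step e t P) = reverse P ++ step e (flip t) []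

  sign-reverse : ∀ {a b} (P : Chain G a b) → chainSign G (reverse P) ≡ chainSign G P
  sign-reverse []           = refl
  sign-reverse (step e t P) = begin
    chainSign G (reverse P ++ step e (flip t) [])   ≡⟨ sign-++ (reverse P) _ ⟩
    chainSign G (reverse P) * (sign e * plus)       ≡⟨ cong (_* (sign e * plus)) (sign-reverse P) ⟩
    chainSign G P * (sign e * plus)                 ≡⟨ cong (chainSign G P *_) (*-identityʳ (sign e)) ⟩
    chainSign G P * sign e                          ≡⟨ *-comm (chainSign G P) (sign e) ⟩
    sign e * chainSign G P                          ∎
    where open ≡-Reasoning

  all-reverse : ∀ {A : E G → Set} {a b} (P : Chain G a b) →
                All A (edges G P) → All A (edges G (reverse P))
  all-reverse []           []       = []
  all-reverse (step e t P) (p ∷ ps) = all-++ (reverse P) _ (all-reverse P ps) (p ∷ [])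

module InsideChain (G : SignedGraph) {x y : V G} (P : Chain G x y) where
  open ChainCalculus G

  Inside : ∀ {a b} → Chain G a b → Set
  Inside Q = All (_∈ edges G P) (edges G Q)

  inside-self : ∀ {a b} (S : Chain G a b) → All (_∈ edges G S) (edges G S)
  inside-self []           = []
  inside-self (step e t S) = here refl ∷ All.map there (inside-self S)

  to-end : ∀ {a} (S : Chain G a y) → Inside S →
           ∀ u → u ∈ verts G S → Σ[ T ∈ Chain G u y ] Inside T
  to-end []           inS       u (here refl) = [] , inS
  to-end (step e t S) inS       u (here refl) = step e t S , inS
  to-end (step e t S) (_ ∷ inS) u (there u∈S) = to-end S inS u u∈S

  reach-end : ∀ u → u ∈ verts G P → Σ[ T ∈ Chain G u y ] Inside T
  reach-end = to-end P (inside-self P)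

  connect : ∀ u v → u ∈ verts G P → v ∈ verts G P → Σ[ Q ∈ Chain G u v ] Inside Q
  connect u v u∈P v∈P with reach-end u u∈P | reach-end v v∈P
  ... | T , inT | T′ , inT′ = T ++ reverse T′ , all-++ T _ inT (all-reverse T′ inT′)

module Endpoints (G : SignedGraph) where

  end-of-edge : ∀ {e a b z w} → Traverses G e a b → Traverses G e z w → (z ≡ a) ⊎ (z ≡ b)
  end-of-edge (inj₁ p) (inj₁ q) = inj₁ (,-injectiveˡ (trans (sym q) p))
  end-of-edge (inj₁ p) (inj₂ q) = inj₂ (,-injectiveʳ (trans (sym q) p))
  end-of-edge (inj₂ p) (inj₁ q) = inj₂ (,-injectiveˡ (trans (sym q) p))
  end-of-edge (inj₂ p) (inj₂ q) = inj₁ (,-injectiveʳ (trans (sym q) p))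

  end-on-chain : ∀ {a b e z w} (P : Chain G a b) → e ∈ edges G P →
                 Traverses G e z w → z ∈ verts G P
  end-on-chain (step e t P) (here refl) t′ with end-of-edge t t′
  ... | inj₁ refl = here refl
  ... | inj₂ refl = there (first P)
    where
      first : ∀ {c d} (Q : Chain G c d) → c ∈ verts G Q
      first []           = here refl
      first (step _ _ _) = here refl
  end-on-chain (step _ _ P) (there e∈P) t′ = there (end-on-chain P e∈P t′)

  -- The base vertex of a cycle using only edges of P lies on P
  -- (a cycle has at least one edge, and its base vertex is an end of it).
  base-on-chain : ∀ {a b z} (P : Chain G a b) (C : Chain G z z) → IsCycle G C →
                  All (_∈ edges G P) (edges G C) → z ∈ verts G P
  base-on-chain P (step e t _) _ (e∈P ∷ _) = end-on-chain P e∈P t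

module SignFlip (G : SignedGraph) where
  open ChainCalculus G

  -- Conjugation W · C · W⁻¹ has the sign of C, as W and W⁻¹ have equal signs.
  sign-conjugate : ∀ {u z} (W : Chain G u z) (C : Chain G z z) →
                   chainSign G (W ++ C ++ reverse W) ≡ chainSign G C
  sign-conjugate W C = begin
    chainSign G (W ++ C ++ reverse W)                          ≡⟨ sign-++ W _ ⟩
    chainSign G W * chainSign G (C ++ reverse W)               ≡⟨ cong (chainSign G W *_) (sign-++ C _) ⟩
    chainSign G W * (chainSign G C * chainSign G (reverse W))  ≡⟨ cong (λ s → chainSign G W * (chainSign G C * s)) (sign-reverse W) ⟩
    chainSign G W * (chainSign G C * chainSign G W)            ≡⟨ cancel (chainSign G W) (chainSign G C) ⟩
    chainSign G C                                              ∎
    where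
      open ≡-Reasoning
      cancel : ∀ s c → s * (c * s) ≡ c
      cancel plus  plus  = refl
      cancel plus  minus = refl
      cancel minus plus  = refl
      cancel minus minus = refl

  sign-negative-prefix : ∀ {u v} (D : Chain G u u) (Q : Chain G u v) →
                         chainSign G D ≡ minus → chainSign G (D ++ Q) ≡ minus * chainSign G Q
  sign-negative-prefix D Q negD = trans (sign-++ D Q) (cong (_* chainSign G Q) negD)

  both-signs : ∀ {A : E G → Set} {u v} (D : Chain G u u) (Q : Chain G u v) →
               chainSign G D ≡ minus → All A (edges G D) → All A (edges G Q) →
               (Σ[ R ∈ Chain G u v ] (chainSign G R ≡ plus)  × All A (edges G R)) ×
               (Σ[ R ∈ Chain G u v ] (chainSign G R ≡ minus) × All A (edges G R))
  both-signs D Q negD inD inQ with chainSign G Q in sgnQ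
  ... | plus  = (Q , sgnQ , inQ) , (D ++ Q , flipped , all-++ D Q inD inQ)
    where
      flipped : chainSign G (D ++ Q) ≡ minus
      flipped = trans (sign-negative-prefix D Q negD) (cong (minus *_) sgnQ)
  ... | minus = (D ++ Q , flipped , all-++ D Q inD inQ) , (Q , sgnQ , inQ)
    where
      flipped : chainSign G (D ++ Q) ≡ plus
      flipped = trans (sign-negative-prefix D Q negD) (cong (minus *_) sgnQ)

lemma3p2 : (G : SignedGraph) → ∀ {x y} (P : Chain G x y) →
    IsHypercyclic G P → SignConnectedIn G P
lemma3p2 G P (_ , _ , z , C , cycC , negC , inC) u v u∈P v∈P =
  inj₂ (both-signs D Q (trans (sign-conjugate W C) negC) inD inQ)
  where
    open ChainCalculus G
    open InsideChain G P
    open Endpoints G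
    open SignFlip G

    z∈P : z ∈ verts G P
    z∈P = base-on-chain P C cycC inC

    Q : Chain G u v
    Q = proj₁ (connect u v u∈P v∈P)

    inQ : Inside Q
    inQ = proj₂ (connect u v u∈P v∈P)

    W : Chain G u z
    W = proj₁ (connect u z u∈P z∈P)

    inW : Inside W
    inW = proj₂ (connect u z u∈P z∈P)

    D : Chain G u u
    D = W ++ C ++ reverse W

    inD : Inside D
    inD = all-++ W _ inW (all-++ C _ inC (all-reverse W inW))
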